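{- Let $\mathcal B\subseteq\mathcal P([n])$ be a simply rooted family with $|\mathcal B|=m$, and let $m'$ be the number of sets $B\in\mathcal B$ with $\delta B\subseteq\mathcal B$. Then $\|\mathcal B\|\le\|\mathcal I(m)\|+m-m'$.
   Context: $\mathcal B$ is simply rooted if for every nonempty $B\in\mathcal B$ there is $b\in B$ with $\{C:\{b\}\subseteq C\subseteq B\}\subseteq\mathcal B$. For a finite set $B$, $\delta B=\{B\setminus\{i\}:i\in B\}$ is its shadow. $\|\mathcal F\|=\sum_{F\in\mathcal F}|F|$. The colex order: $A<B$ iff $\max(A\triangle B)\in B$; $\mathcal I(m)$ is the family of the first $m$ finite sets of positive integers in this order. -}

module Defs where

open import Data.Nat using (ℕ; _≤_; _<_; _>_)
open import Data.Nat.Properties using (_≟_)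
open import Data.List using (List; []; _∷_; length; map; filter)
open import Data.Nat.ListAction using (sum)
open import Data.List.Properties using (≡-dec)
open import Data.List.Relation.Unary.All using (All; all?)
open import Data.List.Relation.Unary.Linked using (Linked)
open import Data.List.Relation.Unary.Unique.Propositional using (Unique)
open import Data.List.Membership.Propositional using (_∈_; _∉_)
open import Data.List.Membership.DecPropositional (≡-dec _≟_) using (_∈?_)
open import Data.Product using (Σ; _×_; ∃-syntax)
open import Function.Bundles using (_⇔_)
open import Relation.Nullary using (¬_; ¬?; Dec)
open import Relation.Binary.PropositionalEquality using (_≡_)

-- A finite set of positive integers, represented canonically as a
-- strictly increasing list of positive naturals.
FSet : Set
FSet = List ℕ

IsFSet : FSet → Set
IsFSet A = Linked _<_ A × All (λ x → 0 < x) A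

InPow : ℕ → FSet → Set
InPow n A = IsFSet A × All (λ x → x ≤ n) A

_⊆ₛ_ : FSet → FSet → Set
C ⊆ₛ B = All (λ x → x ∈ B) C

remove : ℕ → FSet → FSet
remove i B = filter (λ j → ¬? (i ≟ j)) B

ShadowIn : FSet → List FSet → Set
ShadowIn B 𝓑 = All (λ i → remove i B ∈ 𝓑) B

shadowIn? : (𝓑 : List FSet) (B : FSet) → Dec (ShadowIn B 𝓑)
shadowIn? 𝓑 B = all? (λ i → remove i B ∈? 𝓑) B

‖_‖ : List FSet → ℕ
‖ 𝓕 ‖ = sum (map length 𝓕)

m′ : List FSet → ℕ
m′ 𝓑 = length (filter (shadowIn? 𝓑) 𝓑)

SimplyRooted : List FSet → Set
SimplyRooted 𝓑 =
  ∀ B → B ∈ 𝓑 → ¬ (B ≡ []) →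
  ∃[ b ] (b ∈ B × (∀ C → IsFSet C → b ∈ C → C ⊆ₛ B → C ∈ 𝓑))

-- colex order: A < B iff max(A △ B) ∈ B
_<colex_ : FSet → FSet → Set
A <colex B = ∃[ x ] (x ∈ B × x ∉ A × (∀ y → y > x → (y ∈ A ⇔ y ∈ B)))

-- ℐ is (a listing without repetition of) 𝓘(m), the first m finite sets of
-- positive integers in colex order.
IsInitialColex : ℕ → List FSet → Set
IsInitialColex m ℐ =
  length ℐ ≡ m × Unique ℐ × All IsFSet ℐ ×
  (∀ A B → IsFSet A → B ∈ ℐ → A <colex B → A ∈ ℐ)

module Submission where

-- Let degree 𝓑 B be the number of i ∈ B with B ∖ {i} ∈ 𝓑, and edges 𝓑 the
-- sum of the degrees: the number of hypercube edges inside 𝓑.  Then: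
--  (1) Edge-isoperimetric inequality: edges 𝓑 ≤ ones m, where
--      ones m = Σ_{k<m} (number of 1-digits of k).  By induction on the
--      dimension, splitting 𝓑 along the coordinate 0; the inductive step is
--      ones a + ones b + c ≤ ones (a + b) for c ≤ min(a, b), which is proved
--      by halving a, b and c.
--  (2) A root b of B ∈ 𝓑 puts every B ∖ {i}, i ≠ b, in 𝓑, so
--      |B| ≤ degree B + 1, and |B| = degree B when δB ⊆ 𝓑.  Summing over 𝓑
--      gives ‖𝓑‖ + m′ ≤ edges 𝓑 + m.
--  (3) The k-th finite set in colex order is the set of 1-digits of k,
--      shifted by one; hence 𝓘(m) contains these sets for k < m and
--      ones m ≤ ‖𝓘(m)‖.

open import Level using (Level)
open import Function.Base using (_∘_)
open import Function.Bundles using (_⇔_; mk⇔; Equivalence)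
import Function.Properties.Equivalence as ⇔
open import Data.Bool using (true; false; if_then_else_)
open import Data.Nat using (ℕ; zero; suc; _≤_; _<_; _>_; _+_; _∸_; z≤n; s≤s; z<s; s<s; _≡ᵇ_; s≤s⁻¹; s<s⁻¹; ⌊_/2⌋; ⌈_/2⌉)
open import Data.Nat.Properties
open import Data.Nat.Induction using (<-wellFounded)
open import Data.Nat.ListAction using (sum)
open import Data.Nat.ListAction.Properties using (sum-++)
open import Data.Nat.Tactic.RingSolver using (solve-∀)
open import Induction.WellFounded using (Acc; acc)
open import Algebra.Properties.CommutativeSemigroup +-commutativeSemigroup using (interchange; x∙yz≈y∙xz)
open import Data.List using (List; []; _∷_; [_]; _++_; length; map; filter; concatMap; downFrom)
open import Data.List.Properties using (≡-dec; map-++; length-map; length-filter; length-downFrom; filter-all; ∷-injectiveʳ)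
open import Data.List.Relation.Unary.All as All using (All; []; _∷_)
import Data.List.Relation.Unary.All.Properties as All
open import Data.List.Relation.Unary.Any as Any using (here; there)
open import Data.List.Relation.Unary.AllPairs as AllPairs using ([]; _∷_)
import Data.List.Relation.Unary.AllPairs.Properties as AllPairs
open import Data.List.Relation.Unary.Linked as Linked using (Linked; []; [-]; _∷_)
import Data.List.Relation.Unary.Linked.Properties as Linked
open import Data.List.Relation.Unary.Unique.Propositional using (Unique)
import Data.List.Relation.Unary.Unique.Propositional.Properties as Unique
open import Data.List.Membership.Propositional using (_∈_; _∉_)
open import Data.List.Membership.Propositional.Properties
  using (∈-∃++; ∈-++⁻; ∈-++⁺ˡ; ∈-++⁺ʳ; ∈-map⁺; ∈-map⁻; ∈-concatMap⁺; ∈-concatMap⁻;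
         ∈-filter⁺; ∈-filter⁻; ∈-downFrom⁺; ∈-downFrom⁻)
open import Data.List.Membership.DecPropositional (≡-dec _≟_) using (_∈?_)
open import Data.Product using (_×_; _,_; proj₁; proj₂; ∃-syntax)
open import Data.Sum using (inj₁; inj₂)
open import Relation.Nullary using (¬_; ¬?; Dec; yes; no; contradiction)
open import Relation.Unary using (Pred; Decidable)
open import Relation.Binary.Definitions using (tri<; tri≈; tri>)
open import Relation.Binary.PropositionalEquality hiding ([_])
open import Defs

private variable
  a p q : Level
  A B : Set a

-- Σ_{x ∈ xs} f x.  Note that ‖ 𝓕 ‖ is definitionally total length 𝓕.
total : (A → ℕ) → List A → ℕ
total f xs = sum (map f xs)

total-++ : (f : A → ℕ) (xs ys : List A) → total f (xs ++ ys) ≡ total f xs + total f ys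
total-++ f xs ys = trans (cong sum (map-++ f xs ys)) (sum-++ (map f xs) (map f ys))

total-+ : (f g : A → ℕ) (xs : List A) → total (λ x → f x + g x) xs ≡ total f xs + total g xs
total-+ f g [] = refl
total-+ f g (x ∷ xs) =
  trans (cong (f x + g x +_) (total-+ f g xs)) (interchange (f x) (g x) (total f xs) (total g xs))

total-cong : (f g : A → ℕ) (xs : List A) → (∀ {x} → x ∈ xs → f x ≡ g x) → total f xs ≡ total g xs
total-cong f g [] eq = refl
total-cong f g (x ∷ xs) eq = cong₂ _+_ (eq (here refl)) (total-cong f g xs (eq ∘ there))

total-zero : (f : A → ℕ) (xs : List A) → (∀ {x} → x ∈ xs → f x ≡ 0) → total f xs ≡ 0
total-zero f [] _ = refl
total-zero f (x ∷ xs) vanish = cong₂ _+_ (vanish (here refl)) (total-zero f xs (vanish ∘ there))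

total-mono : (f g : A → ℕ) (xs : List A) → (∀ {x} → x ∈ xs → f x ≤ g x) → total f xs ≤ total g xs
total-mono f g [] le = z≤n
total-mono f g (x ∷ xs) le = +-mono-≤ (le (here refl)) (total-mono f g xs (le ∘ there))

total-one : (xs : List A) → total (λ _ → 1) xs ≡ length xs
total-one [] = refl
total-one (x ∷ xs) = cong suc (total-one xs)

total-⊆ : (f : A → ℕ) (xs ys : List A) → Unique xs → All (_∈ ys) xs → total f xs ≤ total f ys
total-⊆ f [] ys _ _ = z≤n
total-⊆ f (x ∷ xs) ys (x∉xs ∷ uxs) (x∈ys ∷ xs⊆ys) with ∈-∃++ x∈ys
... | us , vs , refl = begin
  f x + total f xs             ≤⟨ +-monoʳ-≤ (f x) (total-⊆ f xs (us ++ vs) uxs (dropX xs x∉xs xs⊆ys)) ⟩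
  f x + total f (us ++ vs)     ≡⟨ cong (f x +_) (total-++ f us vs) ⟩
  f x + (total f us + total f vs) ≡⟨ x∙yz≈y∙xz (f x) (total f us) (total f vs) ⟩
  total f us + total f (x ∷ vs) ≡⟨ total-++ f us (x ∷ vs) ⟨
  total f (us ++ x ∷ vs)       ∎
  where
  open ≤-Reasoning
  dropX : ∀ zs → All (λ z → ¬ x ≡ z) zs → All (_∈ us ++ x ∷ vs) zs → All (_∈ us ++ vs) zs
  dropX [] _ _ = []
  dropX (z ∷ zs) (x≢z ∷ x≢zs) (z∈ ∷ zs∈) with ∈-++⁻ us z∈
  ... | inj₁ z∈us = ∈-++⁺ˡ z∈us ∷ dropX zs x≢zs zs∈
  ... | inj₂ (here refl) = contradiction refl x≢z
  ... | inj₂ (there z∈vs) = ∈-++⁺ʳ us z∈vs ∷ dropX zs x≢zs zs∈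

length-⊆ : (xs ys : List A) → Unique xs → All (_∈ ys) xs → length xs ≤ length ys
length-⊆ xs ys uxs xs⊆ys =
  subst₂ _≤_ (total-one xs) (total-one ys) (total-⊆ (λ _ → 1) xs ys uxs xs⊆ys)

𝟙 : {P : Set p} → Dec P → ℕ
𝟙 (yes _) = 1
𝟙 (no _) = 0

𝟙-cong : {P : Set p} {Q : Set q} (p? : Dec P) (q? : Dec Q) → (P → Q) → (Q → P) → 𝟙 p? ≡ 𝟙 q?
𝟙-cong (yes _) (yes _) _ _ = refl
𝟙-cong (no _) (no _) _ _ = refl
𝟙-cong (yes p) (no ¬q) P⇒Q _ = contradiction (P⇒Q p) ¬q
𝟙-cong (no ¬p) (yes q) _ Q⇒P = contradiction (Q⇒P q) ¬p

count : {P : Pred A p} → Decidable P → List A → ℕ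
count P? xs = length (filter P? xs)

count-∷ : {P : Pred A p} (P? : Decidable P) (x : A) (xs : List A) →
          count P? (x ∷ xs) ≡ 𝟙 (P? x) + count P? xs
count-∷ P? x xs with P? x
... | yes _ = refl
... | no _ = refl

total-𝟙 : {P : Pred A p} (P? : Decidable P) (xs : List A) → total (𝟙 ∘ P?) xs ≡ count P? xs
total-𝟙 P? [] = refl
total-𝟙 P? (x ∷ xs) = trans (cong (𝟙 (P? x) +_) (total-𝟙 P? xs)) (sym (count-∷ P? x xs))

count-map : {P : Pred B p} {Q : Pred A q} (P? : Decidable P) (Q? : Decidable Q) (f : A → B) →
            (∀ x → P (f x) → Q x) → (∀ x → Q x → P (f x)) →
            (xs : List A) → count P? (map f xs) ≡ count Q? xs
count-map P? Q? f to from [] = refl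
count-map P? Q? f to from (x ∷ xs) = begin
  count P? (f x ∷ map f xs)          ≡⟨ count-∷ P? (f x) (map f xs) ⟩
  𝟙 (P? (f x)) + count P? (map f xs) ≡⟨ cong₂ _+_ (𝟙-cong (P? (f x)) (Q? x) (to x) (from x))
                                                  (count-map P? Q? f to from xs) ⟩
  𝟙 (Q? x) + count Q? xs             ≡⟨ count-∷ Q? x xs ⟨
  count Q? (x ∷ xs)                  ∎
  where open ≡-Reasoning

count-all-but-one : {P : Pred A p} (P? : Decidable P) (b : A) (xs : List A) → Unique xs →
                    (∀ {x} → x ∈ xs → ¬ x ≡ b → P x) → length xs ≤ count P? xs + 1
count-all-but-one P? b [] _ _ = z≤n
count-all-but-one {P = P} P? b (x ∷ xs) (x∉xs ∷ uxs) good with P? x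
... | yes _ = s≤s (count-all-but-one P? b xs uxs (good ∘ there))
... | no ¬Px = begin
  suc (length xs)      ≡⟨ +-comm 1 (length xs) ⟩
  length xs + 1        ≡⟨ cong (λ ys → length ys + 1) (filter-all P? (All.tabulate rest)) ⟨
  count P? xs + 1      ∎
  where
  open ≤-Reasoning
  -- x is the exceptional element, so every other element is good
  rest : ∀ {y} → y ∈ xs → P y
  rest {y} y∈xs = good (there y∈xs) λ y≡b →
    ¬Px (good (here refl) λ x≡b → All.lookup x∉xs y∈xs (trans x≡b (sym y≡b)))

Below : ℕ → FSet → Set
Below N B = Linked _<_ B × All (_< N) B

Linked-suc⁺ : ∀ {X} → Linked _<_ X → Linked _<_ (map suc X)
Linked-suc⁺ = Linked.map⁺ ∘ Linked.map s<s

Linked-suc⁻ : ∀ {X} → Linked _<_ (map suc X) → Linked _<_ X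
Linked-suc⁻ = Linked.map s<s⁻¹ ∘ Linked.map⁻

Linked-with0 : ∀ {X} → Linked _<_ X → Linked _<_ (0 ∷ map suc X)
Linked-with0 [] = [-]
Linked-with0 X↑@([-]) = z<s ∷ Linked-suc⁺ X↑
Linked-with0 X↑@(_ ∷ _) = z<s ∷ Linked-suc⁺ X↑

Below-unshift₀ : ∀ {N X} → Below (suc N) (map suc X) → Below N X
Below-unshift₀ (X↑ , X<N) = Linked-suc⁻ X↑ , All.gmap⁻ s<s⁻¹ X<N

Below-unshift₁ : ∀ {N X} → Below (suc N) (0 ∷ map suc X) → Below N X
Below-unshift₁ (X↑ , _ ∷ X<N) = Below-unshift₀ (Linked.tail X↑ , X<N)

data Shifted : FSet → Set where
  without0 : ∀ X → Shifted (map suc X)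
  with0    : ∀ X → Shifted (0 ∷ map suc X)

unshift : ∀ Z → All (0 <_) Z → ∃[ X ] Z ≡ map suc X
unshift [] _ = [] , refl
unshift (suc z ∷ Z) (_ ∷ Z>0) with unshift Z Z>0
... | X , refl = z ∷ X , refl

Linked-head : ∀ {x Z} → Linked _<_ (x ∷ Z) → All (x <_) Z
Linked-head [-] = []
Linked-head (x<y ∷ Z↑) = Linked.Linked⇒All <-trans x<y Z↑

shifted : ∀ {Z} → Linked _<_ Z → Shifted Z
shifted {[]} _ = without0 []
shifted {zero ∷ Z} Z↑ with unshift Z (Linked-head Z↑)
... | X , refl = with0 X
shifted {suc z ∷ Z} Z↑ with unshift (suc z ∷ Z) (z<s ∷ All.map (<-trans z<s) (Linked-head Z↑))
... | X , eq = subst Shifted (sym eq) (without0 X)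

remove-0 : ∀ X → remove 0 (map suc X) ≡ map suc X
remove-0 [] = refl
remove-0 (x ∷ X) = cong (suc x ∷_) (remove-0 X)

remove-suc : ∀ i X → remove (suc i) (map suc X) ≡ map suc (remove i X)
remove-suc i [] = refl
remove-suc i (x ∷ X) with i ≡ᵇ x
... | true = remove-suc i X
... | false = cong (suc x ∷_) (remove-suc i X)

IsFSet-Unique : ∀ {B} → IsFSet B → Unique B
IsFSet-Unique (B↑ , _) = AllPairs.map <⇒≢ (Linked.Linked⇒AllPairs <-trans B↑)

IsFSet-remove : ∀ i B → IsFSet B → IsFSet (remove i B)
IsFSet-remove i B (B↑ , B>0) =
  Linked.AllPairs⇒Linked (AllPairs.filter⁺ (¬? ∘ (i ≟_)) (Linked.Linked⇒AllPairs <-trans B↑)) ,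
  All.filter⁺ (¬? ∘ (i ≟_)) B>0

halve-≤ : ∀ {m n} → m + m ≤ n + n → m ≤ n
halve-≤ {m} {n} le = subst₂ _≤_ (sym (n≡⌊n+n/2⌋ m)) (sym (n≡⌊n+n/2⌋ n)) (⌊n/2⌋-mono le)

halve-< : ∀ {m n} → m + m < n + n → m < n
halve-< {m} {n} lt = subst₂ _<_ (sym (n≡⌊n+n/2⌋ m)) (sym (n≡⌈n+n/2⌉ n)) (⌈n/2⌉-mono lt)

data Parity : ℕ → Set where
  even : ∀ k → Parity (k + k)
  odd  : ∀ k → Parity (suc (k + k))

parity : ∀ n → Parity n
parity zero = even 0
parity (suc n) with parity n
... | even k = odd k
... | odd k = subst Parity (cong suc (+-suc k k)) (even (suc k))

binary-induction : (P : ℕ → Set p) → P 0 → (∀ k → P k → P (k + k)) →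
                   (∀ k → P k → P (suc (k + k))) → ∀ n → P n
binary-induction P P0 Peven Podd n = go (parity n) (<-wellFounded n)
  where
  go : ∀ {n} → Parity n → Acc _<_ n → P n
  go (even zero) _ = P0
  go (even (suc k)) (acc rs) = Peven (suc k) (go (parity (suc k)) (rs (m<m+n (suc k) z<s)))
  go (odd k) (acc rs) = Podd k (go (parity k) (rs (s≤s (m≤m+n k k))))

-- addPow p X adds 2^p to the number with binary digit set X, where all
-- elements of X are at least p: binary addition with carry.
addPow : ℕ → List ℕ → List ℕ
addPow p [] = p ∷ []
addPow p (x ∷ xs) = if x ≡ᵇ p then addPow (suc p) xs else p ∷ x ∷ xs

-- binary k is the set of positions of the 1-digits of k (counted from 0).
binary : ℕ → FSet
binary zero = []
binary (suc k) = addPow 0 (binary k)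

addPow-0 : ∀ X → addPow 0 (map suc X) ≡ 0 ∷ map suc X
addPow-0 [] = refl
addPow-0 (x ∷ X) = refl

addPow-suc : ∀ p X → addPow (suc p) (map suc X) ≡ map suc (addPow p X)
addPow-suc p [] = refl
addPow-suc p (x ∷ X) with x ≡ᵇ p
... | true = addPow-suc (suc p) X
... | false = refl

binary-double : ∀ k → binary (k + k) ≡ map suc (binary k)
binary-double+1 : ∀ k → binary (suc (k + k)) ≡ 0 ∷ map suc (binary k)
binary-double+1 k = trans (cong (addPow 0) (binary-double k)) (addPow-0 (binary k))
binary-double zero = refl
binary-double (suc k) = begin
  binary (suc k + suc k)          ≡⟨ cong (binary ∘ suc) (+-suc k k) ⟩
  addPow 0 (binary (suc (k + k))) ≡⟨ cong (addPow 0) (binary-double+1 k) ⟩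
  addPow 1 (map suc (binary k))   ≡⟨ addPow-suc 0 (binary k) ⟩
  map suc (binary (suc k))        ∎
  where open ≡-Reasoning

binary-increasing : ∀ k → Linked _<_ (binary k)
binary-increasing = binary-induction (Linked _<_ ∘ binary) []
  (λ k k↑ → subst (Linked _<_) (sym (binary-double k)) (Linked-suc⁺ k↑))
  (λ k k↑ → subst (Linked _<_) (sym (binary-double+1 k)) (Linked-with0 k↑))

binary-surjective : ∀ N {Z} → Below N Z → ∃[ k ] binary k ≡ Z
binary-surjective zero {[]} _ = 0 , refl
binary-surjective zero {_ ∷ _} (_ , () ∷ _)
binary-surjective (suc N) Z↓ = go (shifted (proj₁ Z↓)) Z↓
  where
  go : ∀ {Z} → Shifted Z → Below (suc N) Z → ∃[ k ] binary k ≡ Z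
  go (without0 X) X↓ with binary-surjective N (Below-unshift₀ X↓)
  ... | k , refl = k + k , binary-double k
  go (with0 X) X↓ with binary-surjective N (Below-unshift₁ X↓)
  ... | k , refl = suc (k + k) , binary-double+1 k

Lift : FSet → FSet → Set
Lift X X′ = ∀ y → (suc y ∈ X′) ⇔ (y ∈ X)

∈-suc⁻ : ∀ {y X} → suc y ∈ map suc X → y ∈ X
∈-suc⁻ sy∈ with ∈-map⁻ suc sy∈
... | _ , y∈ , refl = y∈

0∉-suc : ∀ X → 0 ∉ map suc X
0∉-suc X 0∈ with ∈-map⁻ suc 0∈
... | _ , _ , ()

lift-suc : ∀ X → Lift X (map suc X)
lift-suc X y = mk⇔ ∈-suc⁻ (∈-map⁺ suc)

lift-with0 : ∀ X → Lift X (0 ∷ map suc X)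
lift-with0 X y = mk⇔ (λ { (here ()) ; (there sy∈) → ∈-suc⁻ sy∈ }) (there ∘ ∈-map⁺ suc)

lift-double : ∀ k → Lift (binary k) (binary (k + k))
lift-double k = subst (Lift (binary k)) (sym (binary-double k)) (lift-suc (binary k))

lift-double+1 : ∀ k → Lift (binary k) (binary (suc (k + k)))
lift-double+1 k = subst (Lift (binary k)) (sym (binary-double+1 k)) (lift-with0 (binary k))

lift-colex : ∀ {X X′ Y Y′} → Lift X X′ → Lift Y Y′ → X <colex Y → X′ <colex Y′
lift-colex {X′ = X′} {Y′ = Y′} liftX liftY (x , x∈Y , x∉X , above) =
  suc x , Equivalence.from (liftY x) x∈Y , x∉X ∘ Equivalence.to (liftX x) , agree
  where
  agree : ∀ y → y > suc x → (y ∈ X′) ⇔ (y ∈ Y′)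
  agree (suc y) (s<s x<y) = ⇔.trans (liftX y) (⇔.trans (above y x<y) (⇔.sym (liftY y)))

parity-colex : ∀ {X X′ X″} → Lift X X′ → Lift X X″ → 0 ∉ X′ → 0 ∈ X″ → X′ <colex X″
parity-colex {X′ = X′} {X″ = X″} liftX′ liftX″ 0∉X′ 0∈X″ = 0 , 0∈X″ , 0∉X′ , agree
  where
  agree : ∀ y → y > 0 → (y ∈ X′) ⇔ (y ∈ X″)
  agree (suc y) _ = ⇔.trans (liftX′ y) (⇔.sym (liftX″ y))

binary-colex : ∀ j {k} → k < j → binary k <colex binary j
binary-colex = binary-induction (λ j → ∀ {k} → k < j → binary k <colex binary j) (λ ())
  (λ J IH k<j → fromEven J IH (parity _) k<j)
  (λ J IH k<j → fromOdd J IH (parity _) k<j)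
  where
  Below-colex : ℕ → Set
  Below-colex J = ∀ {k} → k < J → binary k <colex binary J

  fromEven : ∀ J → Below-colex J → ∀ {k} → Parity k → k < J + J → binary k <colex binary (J + J)
  fromEven J IH (even K) lt = lift-colex (lift-double K) (lift-double J) (IH {K} (halve-< lt))
  fromEven J IH (odd K) lt = lift-colex (lift-double+1 K) (lift-double J) (IH {K} (halve-< (<-trans (n<1+n _) lt)))

  fromOdd : ∀ J → Below-colex J → ∀ {k} → Parity k → k < suc (J + J) → binary k <colex binary (suc (J + J))
  fromOdd J IH (odd K) lt = lift-colex (lift-double+1 K) (lift-double+1 J) (IH {K} (halve-< (s<s⁻¹ lt)))
  fromOdd J IH (even K) lt with m≤n⇒m<n∨m≡n {K} {J} (halve-≤ (s≤s⁻¹ lt))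
  ... | inj₁ K<J = lift-colex (lift-double K) (lift-double+1 J) (IH {K} K<J)
  ... | inj₂ refl = parity-colex (lift-double K) (lift-double+1 K) 0∉ 0∈
    where
    0∉ : 0 ∉ binary (K + K)
    0∉ = subst (0 ∉_) (sym (binary-double K)) (0∉-suc (binary K))
    0∈ : 0 ∈ binary (suc (K + K))
    0∈ = subst (0 ∈_) (sym (binary-double+1 K)) (here refl)

popcount : ℕ → ℕ
popcount k = length (binary k)

ones : ℕ → ℕ
ones m = total popcount (downFrom m)

popcount-double : ∀ k → popcount (k + k) ≡ popcount k
popcount-double k = trans (cong length (binary-double k)) (length-map suc (binary k))

popcount-double+1 : ∀ k → popcount (suc (k + k)) ≡ suc (popcount k)
popcount-double+1 k = trans (cong length (binary-double+1 k)) (cong suc (length-map suc (binary k)))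

popcount-suc : ∀ n → popcount (suc n) ≤ suc (popcount n)
popcount-suc = binary-induction (λ n → popcount (suc n) ≤ suc (popcount n)) ≤-refl
  (λ k _ → ≤-reflexive (trans (popcount-double+1 k) (cong suc (sym (popcount-double k)))))
  (λ k IH → begin
     popcount (suc (suc (k + k)))  ≡⟨ cong popcount (sym (+-suc (suc k) k)) ⟩
     popcount (suc k + suc k)      ≡⟨ popcount-double (suc k) ⟩
     popcount (suc k)              ≤⟨ IH ⟩
     suc (popcount k)              ≤⟨ n≤1+n _ ⟩
     suc (suc (popcount k))        ≡⟨ cong suc (popcount-double+1 k) ⟨
     suc (popcount (suc (k + k)))  ∎)
  where open ≤-Reasoning

ones-double : ∀ k → ones (k + k) ≡ ones k + ones k + k
ones-double zero = refl
ones-double (suc k) = begin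
  ones (suc k + suc k)                                    ≡⟨ cong (ones ∘ suc) (+-suc k k) ⟩
  popcount (suc (k + k)) + (popcount (k + k) + ones (k + k))
    ≡⟨ cong₂ (λ x y → x + (y + ones (k + k))) (popcount-double+1 k) (popcount-double k) ⟩
  suc (popcount k) + (popcount k + ones (k + k))          ≡⟨ cong (λ x → suc (popcount k) + (popcount k + x)) (ones-double k) ⟩
  suc (popcount k) + (popcount k + (ones k + ones k + k)) ≡⟨ regroup (popcount k) (ones k) k ⟩
  ones (suc k) + ones (suc k) + suc k                     ∎
  where
  open ≡-Reasoning
  regroup : ∀ p o k → suc p + (p + (o + o + k)) ≡ (p + o) + (p + o) + suc k
  regroup = solve-∀

ones-double+1 : ∀ k → ones (suc (k + k)) ≡ ones (suc k) + ones k + k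
ones-double+1 k = begin
  popcount (k + k) + ones (k + k)   ≡⟨ cong₂ _+_ (popcount-double k) (ones-double k) ⟩
  popcount k + (ones k + ones k + k) ≡⟨ regroup (popcount k) (ones k) k ⟩
  ones (suc k) + ones k + k         ∎
  where
  open ≡-Reasoning
  regroup : ∀ p o k → p + (o + o + k) ≡ (p + o) + o + k
  regroup = solve-∀

ones-halve : ∀ n → ones n ≡ ones ⌈ n /2⌉ + ones ⌊ n /2⌋ + ⌊ n /2⌋
ones-halve n = go (parity n)
  where
  go : ∀ {n} → Parity n → ones n ≡ ones ⌈ n /2⌉ + ones ⌊ n /2⌋ + ⌊ n /2⌋
  go (even k) = trans (ones-double k) (cong₂ (λ x y → ones x + ones y + y) (n≡⌈n+n/2⌉ k) (n≡⌊n+n/2⌋ k))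
  go (odd k) = trans (ones-double+1 k) (cong₂ (λ x y → ones (suc x) + ones y + y) (n≡⌊n+n/2⌋ k) (n≡⌈n+n/2⌉ k))

⌈n/2⌉≤1+⌊n/2⌋ : ∀ n → ⌈ n /2⌉ ≤ suc ⌊ n /2⌋
⌈n/2⌉≤1+⌊n/2⌋ zero = z≤n
⌈n/2⌉≤1+⌊n/2⌋ (suc zero) = ≤-refl
⌈n/2⌉≤1+⌊n/2⌋ (suc (suc n)) = s≤s (⌈n/2⌉≤1+⌊n/2⌋ n)

ones-merge : ∀ u v → v ≤ u → u ≤ 2 + v → ones u + ones v + v ≤ ones (u + v)
ones-merge u v v≤u u≤2+v with m≤n⇒∃[o]m+o≡n v≤u
... | d , refl = subst (λ w → ones w + ones v + v ≤ ones (w + v)) (+-comm d v)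
                   (merge d (+-cancelʳ-≤ v d 2 (subst (_≤ 2 + v) (+-comm v d) u≤2+v)))
  where
  open ≤-Reasoning
  regroup : ∀ p o v → suc p + (p + o) + o + v ≡ (p + o) + (p + o) + suc v
  regroup = solve-∀
  merge : ∀ d → d ≤ 2 → ones (d + v) + ones v + v ≤ ones (d + v + v)
  merge 0 _ = ≤-reflexive (sym (ones-double v))
  merge 1 _ = ≤-reflexive (sym (ones-double+1 v))
  merge 2 _ = begin
    popcount (suc v) + ones (suc v) + ones v + v
      ≤⟨ +-monoˡ-≤ v (+-monoˡ-≤ (ones v) (+-monoˡ-≤ (ones (suc v)) (popcount-suc v))) ⟩
    suc (popcount v) + ones (suc v) + ones v + v  ≡⟨ regroup (popcount v) (ones v) v ⟩
    ones (suc v) + ones (suc v) + suc v           ≡⟨ ones-double (suc v) ⟨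
    ones (suc v + suc v)                          ≡⟨ cong ones (+-suc (suc v) v) ⟩
    ones (2 + v + v)                              ∎
  merge (suc (suc (suc _))) (s≤s (s≤s ()))

Superadditive : ℕ → ℕ → Set
Superadditive a b = ∀ c → c ≤ a → c ≤ b → ones a + ones b + c ≤ ones (a + b)

halving-step : ∀ a b → Superadditive ⌈ a /2⌉ ⌈ b /2⌉ → Superadditive ⌊ a /2⌋ ⌊ b /2⌋ → Superadditive a b
halving-step a b upper lower c c≤a c≤b = begin
  ones a + ones b + c
    ≡⟨ cong₂ _+_ (cong₂ _+_ (ones-halve a) (ones-halve b)) (sym (halves c)) ⟩
  (ones a⁺ + ones a⁻ + a⁻) + (ones b⁺ + ones b⁻ + b⁻) + (c⁺ + c⁻)
    ≡⟨ regroup (ones a⁺) (ones a⁻) a⁻ (ones b⁺) (ones b⁻) b⁻ c⁺ c⁻ ⟩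
  (ones a⁺ + ones b⁺ + c⁺) + (ones a⁻ + ones b⁻ + c⁻) + (a⁻ + b⁻)
    ≤⟨ +-monoˡ-≤ (a⁻ + b⁻) (+-mono-≤ (upper c⁺ (⌈n/2⌉-mono c≤a) (⌈n/2⌉-mono c≤b))
                                      (lower c⁻ (⌊n/2⌋-mono c≤a) (⌊n/2⌋-mono c≤b))) ⟩
  ones (a⁺ + b⁺) + ones (a⁻ + b⁻) + (a⁻ + b⁻)
    ≤⟨ ones-merge (a⁺ + b⁺) (a⁻ + b⁻) (+-mono-≤ (⌊n/2⌋≤⌈n/2⌉ a) (⌊n/2⌋≤⌈n/2⌉ b)) near ⟩
  ones (a⁺ + b⁺ + (a⁻ + b⁻))
    ≡⟨ cong ones (trans (interchange a⁺ b⁺ a⁻ b⁻) (cong₂ _+_ (halves a) (halves b))) ⟩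
  ones (a + b) ∎
  where
  open ≤-Reasoning
  a⁺ a⁻ b⁺ b⁻ c⁺ c⁻ : ℕ
  a⁺ = ⌈ a /2⌉
  a⁻ = ⌊ a /2⌋
  b⁺ = ⌈ b /2⌉
  b⁻ = ⌊ b /2⌋
  c⁺ = ⌈ c /2⌉
  c⁻ = ⌊ c /2⌋
  halves : ∀ n → ⌈ n /2⌉ + ⌊ n /2⌋ ≡ n
  halves n = trans (+-comm ⌈ n /2⌉ ⌊ n /2⌋) (⌊n/2⌋+⌈n/2⌉≡n n)
  near : a⁺ + b⁺ ≤ 2 + (a⁻ + b⁻)
  near = ≤-trans (+-mono-≤ (⌈n/2⌉≤1+⌊n/2⌋ a) (⌈n/2⌉≤1+⌊n/2⌋ b)) (≤-reflexive (cong suc (+-suc a⁻ b⁻)))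
  regroup : ∀ A⁺ A⁻ a⁻ B⁺ B⁻ b⁻ c⁺ c⁻ →
    (A⁺ + A⁻ + a⁻) + (B⁺ + B⁻ + b⁻) + (c⁺ + c⁻) ≡ (A⁺ + B⁺ + c⁺) + (A⁻ + B⁻ + c⁻) + (a⁻ + b⁻)
  regroup = solve-∀

ones-superadditive : ∀ a b → Superadditive a b
ones-superadditive a b = go a b (<-wellFounded (a + b))
  where
  go : ∀ a b → Acc _<_ (a + b) → Superadditive a b
  go zero b _ .zero z≤n _ = ≤-reflexive (+-identityʳ (ones b))
  go a@(suc _) zero _ .zero _ z≤n =
    ≤-reflexive (trans (+-identityʳ _) (trans (+-identityʳ (ones a)) (cong ones (sym (+-identityʳ a)))))
  go 1 1 _ c c≤1 _ = c≤1
  go 1 b@(suc (suc b′)) (acc rs) =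
    halving-step 1 b (go 1 _ (rs (s<s (⌈n/2⌉<n b′)))) (go 0 _ (rs (s≤s (⌊n/2⌋≤n b))))
  go a@(suc (suc a′)) b@(suc _) (acc rs) =
    halving-step a b (go _ _ (rs (+-mono-<-≤ (⌈n/2⌉<n a′) (⌈n/2⌉≤n b))))
                     (go _ _ (rs (+-mono-<-≤ (⌊n/2⌋<n (suc a′)) (⌊n/2⌋≤n b))))

degree : List FSet → FSet → ℕ
degree 𝓑 B = count (λ i → remove i B ∈? 𝓑) B

edges : List FSet → ℕ
edges 𝓑 = total (degree 𝓑) 𝓑

Unique-concatMap : (f : A → List B) → (∀ x → Unique (f x)) →
                   (∀ {x x′ y} → y ∈ f x → y ∈ f x′ → x ≡ x′) →
                   ∀ {xs} → Unique xs → Unique (concatMap f xs)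
Unique-concatMap f uf source [] = []
Unique-concatMap f uf source {x ∷ xs} (x∉xs ∷ uxs) =
  Unique.++⁺ (uf x) (Unique-concatMap f uf source uxs) disjoint
  where
  disjoint : ∀ {y} → ¬ (y ∈ f x × y ∈ concatMap f xs)
  disjoint (y∈fx , y∈rest) =
    Unique.Unique[x∷xs]⇒x∉xs (x∉xs ∷ uxs) (Any.map (source y∈fx) (∈-concatMap⁻ f y∈rest))

-- The two slices of 𝓑 along the coordinate 0, shifted down by one:
-- slice₀ 𝓑 = {X : X + 1 ∈ 𝓑} and slice₁ 𝓑 = {X : {0} ∪ (X + 1) ∈ 𝓑}.
-- unshift₀ B is [ X ] if B = map suc X, and [] otherwise;
-- unshift₁ B is [ X ] if B = 0 ∷ map suc X, and [] otherwise.
unshift₀ : FSet → List FSet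
unshift₀ [] = [ [] ]
unshift₀ (zero ∷ _) = []
unshift₀ (suc x ∷ B) = map (x ∷_) (unshift₀ B)

unshift₁ : FSet → List FSet
unshift₁ (zero ∷ B) = unshift₀ B
unshift₁ _ = []

slice₀ : List FSet → List FSet
slice₀ = concatMap unshift₀

slice₁ : List FSet → List FSet
slice₁ = concatMap unshift₁

unshift₀-suc : ∀ X → unshift₀ (map suc X) ≡ [ X ]
unshift₀-suc [] = refl
unshift₀-suc (x ∷ X) = cong (map (x ∷_)) (unshift₀-suc X)

unshift₁-suc : ∀ X → unshift₁ (map suc X) ≡ []
unshift₁-suc [] = refl
unshift₁-suc (x ∷ X) = refl

∈-unshift₀ : ∀ {X} B → X ∈ unshift₀ B → map suc X ≡ B
∈-unshift₀ [] (here refl) = refl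
∈-unshift₀ (suc x ∷ B) X∈ with ∈-map⁻ (x ∷_) X∈
... | Y , Y∈ , refl = cong (suc x ∷_) (∈-unshift₀ B Y∈)

∈-unshift₁ : ∀ {X} B → X ∈ unshift₁ B → 0 ∷ map suc X ≡ B
∈-unshift₁ (zero ∷ B) X∈ = cong (0 ∷_) (∈-unshift₀ B X∈)

Unique-unshift₀ : ∀ B → Unique (unshift₀ B)
Unique-unshift₀ [] = [] ∷ []
Unique-unshift₀ (zero ∷ B) = []
Unique-unshift₀ (suc x ∷ B) = Unique.map⁺ ∷-injectiveʳ (Unique-unshift₀ B)

Unique-unshift₁ : ∀ B → Unique (unshift₁ B)
Unique-unshift₁ [] = []
Unique-unshift₁ (zero ∷ B) = Unique-unshift₀ B
Unique-unshift₁ (suc _ ∷ _) = []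

∈-slice₀ : ∀ {X} 𝓑 → X ∈ slice₀ 𝓑 ⇔ map suc X ∈ 𝓑
∈-slice₀ {X} 𝓑 = mk⇔ (Any.map (λ {B} X∈ → ∈-unshift₀ B X∈) ∘ ∈-concatMap⁻ unshift₀)
                     (∈-concatMap⁺ unshift₀ ∘ Any.map (λ { refl → subst (X ∈_) (sym (unshift₀-suc X)) (here refl) }))

∈-slice₁ : ∀ {X} 𝓑 → X ∈ slice₁ 𝓑 ⇔ 0 ∷ map suc X ∈ 𝓑
∈-slice₁ {X} 𝓑 = mk⇔ (Any.map (λ {B} X∈ → ∈-unshift₁ B X∈) ∘ ∈-concatMap⁻ unshift₁)
                     (∈-concatMap⁺ unshift₁ ∘ Any.map (λ { refl → subst (X ∈_) (sym (unshift₀-suc X)) (here refl) }))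

Unique-slice₀ : ∀ {𝓑} → Unique 𝓑 → Unique (slice₀ 𝓑)
Unique-slice₀ = Unique-concatMap unshift₀ Unique-unshift₀
  (λ {B} {B′} X∈ X∈′ → trans (sym (∈-unshift₀ B X∈)) (∈-unshift₀ B′ X∈′))

Unique-slice₁ : ∀ {𝓑} → Unique 𝓑 → Unique (slice₁ 𝓑)
Unique-slice₁ = Unique-concatMap unshift₁ Unique-unshift₁
  (λ {B} {B′} X∈ X∈′ → trans (sym (∈-unshift₁ B X∈)) (∈-unshift₁ B′ X∈′))

total-slices : (g : FSet → ℕ) → ∀ 𝓑 → All Shifted 𝓑 →
               total g 𝓑 ≡ total (g ∘ map suc) (slice₀ 𝓑) + total (g ∘ (0 ∷_) ∘ map suc) (slice₁ 𝓑)
total-slices g [] [] = refl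
total-slices g (.(map suc X) ∷ 𝓑) (without0 X ∷ sh)
  rewrite unshift₀-suc X | unshift₁-suc X | total-slices g 𝓑 sh =
  sym (+-assoc (g (map suc X)) _ _)
total-slices g (.(0 ∷ map suc X) ∷ 𝓑) (with0 X ∷ sh)
  rewrite unshift₀-suc X | total-slices g 𝓑 sh =
  x∙yz≈y∙xz (g (0 ∷ map suc X)) (total (g ∘ map suc) (slice₀ 𝓑)) (total (g ∘ (0 ∷_) ∘ map suc) (slice₁ 𝓑))

degree-without0 : ∀ 𝓑 X → degree 𝓑 (map suc X) ≡ degree (slice₀ 𝓑) X
degree-without0 𝓑 X = count-map (λ i → remove i (map suc X) ∈? 𝓑) (λ i → remove i X ∈? slice₀ 𝓑) suc
  (λ i p → Equivalence.from (∈-slice₀ 𝓑) (subst (_∈ 𝓑) (remove-suc i X) p))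
  (λ i p → subst (_∈ 𝓑) (sym (remove-suc i X)) (Equivalence.to (∈-slice₀ 𝓑) p)) X

-- A member containing 0 has one extra neighbour, namely itself minus 0,
-- exactly when that set lies in the other slice.
degree-with0 : ∀ 𝓑 X → degree 𝓑 (0 ∷ map suc X) ≡ 𝟙 (X ∈? slice₀ 𝓑) + degree (slice₁ 𝓑) X
degree-with0 𝓑 X = trans (count-∷ (λ i → remove i (0 ∷ map suc X) ∈? 𝓑) 0 (map suc X))
  (cong₂ _+_ (𝟙-cong (remove 0 (map suc X) ∈? 𝓑) (X ∈? slice₀ 𝓑)
                (λ p → Equivalence.from (∈-slice₀ 𝓑) (subst (_∈ 𝓑) (remove-0 X) p))
                (λ p → subst (_∈ 𝓑) (sym (remove-0 X)) (Equivalence.to (∈-slice₀ 𝓑) p)))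
             (count-map (λ i → remove i (0 ∷ map suc X) ∈? 𝓑) (λ i → remove i X ∈? slice₁ 𝓑) suc
                (λ i p → Equivalence.from (∈-slice₁ 𝓑) (subst (_∈ 𝓑) (cong (0 ∷_) (remove-suc i X)) p))
                (λ i p → subst (_∈ 𝓑) (cong (0 ∷_) (sym (remove-suc i X))) (Equivalence.to (∈-slice₁ 𝓑) p)) X))

-- Splitting along 0: the edges inside each slice, plus the edge between
-- X + 1 and {0} ∪ (X + 1) for every X lying in both slices.
edges-slices : ∀ 𝓑 → All Shifted 𝓑 →
  edges 𝓑 ≡ edges (slice₀ 𝓑) + edges (slice₁ 𝓑) + count (_∈? slice₀ 𝓑) (slice₁ 𝓑)
edges-slices 𝓑 sh = begin
  edges 𝓑
    ≡⟨ total-slices (degree 𝓑) 𝓑 sh ⟩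
  total (degree 𝓑 ∘ map suc) 𝓢₀ + total (degree 𝓑 ∘ (0 ∷_) ∘ map suc) 𝓢₁
    ≡⟨ cong₂ _+_ (total-cong (degree 𝓑 ∘ map suc) (degree 𝓢₀) 𝓢₀ (λ {X} _ → degree-without0 𝓑 X))
                 (total-cong (degree 𝓑 ∘ (0 ∷_) ∘ map suc) (λ X → 𝟙 (X ∈? 𝓢₀) + degree 𝓢₁ X) 𝓢₁
                             (λ {X} _ → degree-with0 𝓑 X)) ⟩
  edges 𝓢₀ + total (λ X → 𝟙 (X ∈? 𝓢₀) + degree 𝓢₁ X) 𝓢₁
    ≡⟨ cong (edges 𝓢₀ +_) (total-+ (𝟙 ∘ (_∈? 𝓢₀)) (degree 𝓢₁) 𝓢₁) ⟩
  edges 𝓢₀ + (total (𝟙 ∘ (_∈? 𝓢₀)) 𝓢₁ + edges 𝓢₁)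
    ≡⟨ cong (λ c → edges 𝓢₀ + (c + edges 𝓢₁)) (total-𝟙 (_∈? 𝓢₀) 𝓢₁) ⟩
  edges 𝓢₀ + (count (_∈? 𝓢₀) 𝓢₁ + edges 𝓢₁)
    ≡⟨ trans (cong (edges 𝓢₀ +_) (+-comm _ (edges 𝓢₁))) (sym (+-assoc (edges 𝓢₀) (edges 𝓢₁) _)) ⟩
  edges 𝓢₀ + edges 𝓢₁ + count (_∈? 𝓢₀) 𝓢₁ ∎
  where
  open ≡-Reasoning
  𝓢₀ 𝓢₁ : List FSet
  𝓢₀ = slice₀ 𝓑
  𝓢₁ = slice₁ 𝓑

size-slices : ∀ 𝓑 → All Shifted 𝓑 → length 𝓑 ≡ length (slice₀ 𝓑) + length (slice₁ 𝓑)
size-slices 𝓑 sh = begin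
  length 𝓑                                                 ≡⟨ total-one 𝓑 ⟨
  total (λ _ → 1) 𝓑                                        ≡⟨ total-slices (λ _ → 1) 𝓑 sh ⟩
  total (λ _ → 1) (slice₀ 𝓑) + total (λ _ → 1) (slice₁ 𝓑)  ≡⟨ cong₂ _+_ (total-one (slice₀ 𝓑)) (total-one (slice₁ 𝓑)) ⟩
  length (slice₀ 𝓑) + length (slice₁ 𝓑)                    ∎
  where open ≡-Reasoning

edges-≤-ones : ∀ N 𝓑 → All (Below N) 𝓑 → Unique 𝓑 → edges 𝓑 ≤ ones (length 𝓑)
edges-≤-ones zero 𝓑 𝓑↓ _ = ≤-trans (≤-reflexive (total-zero (degree 𝓑) 𝓑 (isolated ∘ All.lookup 𝓑↓))) z≤n
  where
  isolated : ∀ {B} → Below 0 B → degree 𝓑 B ≡ 0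
  isolated {[]} _ = refl
  isolated {_ ∷ _} (_ , () ∷ _)
edges-≤-ones (suc N) 𝓑 𝓑↓ u𝓑 = begin
  edges 𝓑                                       ≡⟨ edges-slices 𝓑 sh ⟩
  edges 𝓢₀ + edges 𝓢₁ + common                  ≤⟨ +-monoˡ-≤ common (+-mono-≤ (edges-≤-ones N 𝓢₀ 𝓢₀↓ u𝓢₀)
                                                                             (edges-≤-ones N 𝓢₁ 𝓢₁↓ u𝓢₁)) ⟩
  ones (length 𝓢₀) + ones (length 𝓢₁) + common  ≤⟨ ones-superadditive (length 𝓢₀) (length 𝓢₁) common common≤₀ common≤₁ ⟩
  ones (length 𝓢₀ + length 𝓢₁)                  ≡⟨ cong ones (size-slices 𝓑 sh) ⟨
  ones (length 𝓑)                               ∎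
  where
  open ≤-Reasoning
  𝓢₀ 𝓢₁ : List FSet
  𝓢₀ = slice₀ 𝓑
  𝓢₁ = slice₁ 𝓑
  sh : All Shifted 𝓑
  sh = All.map (shifted ∘ proj₁) 𝓑↓
  𝓢₀↓ : All (Below N) 𝓢₀
  𝓢₀↓ = All.tabulate (λ X∈ → Below-unshift₀ (All.lookup 𝓑↓ (Equivalence.to (∈-slice₀ 𝓑) X∈)))
  𝓢₁↓ : All (Below N) 𝓢₁
  𝓢₁↓ = All.tabulate (λ X∈ → Below-unshift₁ (All.lookup 𝓑↓ (Equivalence.to (∈-slice₁ 𝓑) X∈)))
  u𝓢₀ : Unique 𝓢₀
  u𝓢₀ = Unique-slice₀ u𝓑
  u𝓢₁ : Unique 𝓢₁
  u𝓢₁ = Unique-slice₁ u𝓑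
  common : ℕ
  common = count (_∈? 𝓢₀) 𝓢₁
  common≤₀ : common ≤ length 𝓢₀
  common≤₀ = length-⊆ (filter (_∈? 𝓢₀) 𝓢₁) 𝓢₀ (Unique.filter⁺ (_∈? 𝓢₀) u𝓢₁)
               (All.tabulate (λ X∈ → proj₂ (∈-filter⁻ (_∈? 𝓢₀) {xs = 𝓢₁} X∈)))
  common≤₁ : common ≤ length 𝓢₁
  common≤₁ = length-filter (_∈? 𝓢₀) 𝓢₁

-- In a simply rooted family, a member B with root b has every B ∖ {i},
-- i ≠ b, in the family: at most one lower neighbour is missing, and none
-- is missing when δB ⊆ 𝓑.
size-≤-degree : ∀ 𝓑 → SimplyRooted 𝓑 → ∀ {B} → B ∈ 𝓑 → IsFSet B →
                length B + 𝟙 (shadowIn? 𝓑 B) ≤ degree 𝓑 B + 1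
size-≤-degree 𝓑 rooted {[]} _ _ = ≤-refl
size-≤-degree 𝓑 rooted {B@(_ ∷ _)} B∈𝓑 B-set with shadowIn? 𝓑 B
... | yes δB⊆𝓑 = ≤-reflexive (cong (λ xs → length xs + 1) (sym (filter-all (λ i → remove i B ∈? 𝓑) δB⊆𝓑)))
... | no _ with rooted B B∈𝓑 (λ ())
...   | b , b∈B , upward = ≤-trans (≤-reflexive (+-identityʳ (length B)))
          (count-all-but-one (λ i → remove i B ∈? 𝓑) b B (IsFSet-Unique B-set) lower)
  where
  lower : ∀ {i} → i ∈ B → ¬ i ≡ b → remove i B ∈ 𝓑
  lower {i} _ i≢b = upward (remove i B) (IsFSet-remove i B B-set) (∈-filter⁺ (¬? ∘ (i ≟_)) b∈B i≢b)
                      (All.tabulate (proj₁ ∘ ∈-filter⁻ (¬? ∘ (i ≟_)) {xs = B}))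

norm+full≤edges+size : ∀ 𝓑 → SimplyRooted 𝓑 → All IsFSet 𝓑 → ‖ 𝓑 ‖ + m′ 𝓑 ≤ edges 𝓑 + length 𝓑
norm+full≤edges+size 𝓑 rooted sets = begin
  ‖ 𝓑 ‖ + m′ 𝓑                                   ≡⟨ cong (‖ 𝓑 ‖ +_) (total-𝟙 (shadowIn? 𝓑) 𝓑) ⟨
  total length 𝓑 + total (𝟙 ∘ shadowIn? 𝓑) 𝓑       ≡⟨ total-+ length (𝟙 ∘ shadowIn? 𝓑) 𝓑 ⟨
  total (λ B → length B + 𝟙 (shadowIn? 𝓑 B)) 𝓑    ≤⟨ total-mono _ _ 𝓑 (λ B∈ → size-≤-degree 𝓑 rooted B∈ (All.lookup sets B∈)) ⟩
  total (λ B → degree 𝓑 B + 1) 𝓑                  ≡⟨ total-+ (degree 𝓑) (λ _ → 1) 𝓑 ⟩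
  edges 𝓑 + total (λ _ → 1) 𝓑                     ≡⟨ cong (edges 𝓑 +_) (total-one 𝓑) ⟩
  edges 𝓑 + length 𝓑                              ∎
  where open ≤-Reasoning

-- colexSet k = binary k shifted by one; it is the k-th finite set of positive
-- integers in colex order (counting from 0), as the lemmas below show.
colexSet : ℕ → FSet
colexSet k = map suc (binary k)

colexSet-IsFSet : ∀ k → IsFSet (colexSet k)
colexSet-IsFSet k = Linked-suc⁺ (binary-increasing k) , All.map⁺ (All.universal (λ _ → z<s) (binary k))

colexSet-colex : ∀ {k j} → k < j → colexSet k <colex colexSet j
colexSet-colex {j = j} k<j = lift-colex (lift-suc _) (lift-suc _) (binary-colex j k<j)

colex-irrefl : ∀ {A} → ¬ (A <colex A)
colex-irrefl (_ , x∈A , x∉A , _) = x∉A x∈A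

colexSet-injective : ∀ {j k} → colexSet j ≡ colexSet k → j ≡ k
colexSet-injective {j} {k} eq with <-cmp j k
... | tri≈ _ j≡k _ = j≡k
... | tri< j<k _ _ = contradiction (subst (colexSet j <colex_) (sym eq) (colexSet-colex j<k)) colex-irrefl
... | tri> _ _ k<j = contradiction (subst (_<colex colexSet j) (sym eq) (colexSet-colex k<j)) colex-irrefl

upper-bound : ∀ Z → ∃[ N ] All (_< N) Z
upper-bound [] = 0 , []
upper-bound (z ∷ Z) with upper-bound Z
... | N , Z<N = suc z + N , s≤s (m≤m+n z N) ∷ All.map (λ x<N → ≤-trans x<N (m≤n+m N (suc z))) Z<N

colexSet-surjective : ∀ {A} → IsFSet A → ∃[ k ] colexSet k ≡ A
colexSet-surjective {A} (A↑ , A>0) with unshift A A>0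
... | Z , refl with upper-bound Z
...   | N , Z<N with binary-surjective N (Linked-suc⁻ A↑ , Z<N)
...     | k , refl = k , refl

colexPrefix : ℕ → List FSet
colexPrefix m = map colexSet (downFrom m)

norm-colexPrefix : ∀ m → ‖ colexPrefix m ‖ ≡ ones m
norm-colexPrefix zero = refl
norm-colexPrefix (suc m) = cong₂ _+_ (length-map suc (binary m)) (norm-colexPrefix m)

-- A down-closed family of m finite sets contains the first m sets in colex
-- order: otherwise all its members would come before colexSet k, k < m.
initial-contains : ∀ {m ℐ} → IsInitialColex m ℐ → ∀ {k} → k < m → colexSet k ∈ ℐ
initial-contains {m} {ℐ} (|ℐ|≡m , uℐ , sets , downward) {k} k<m with colexSet k ∈? ℐ
... | yes k∈ℐ = k∈ℐ
... | no k∉ℐ = contradiction m≤k (<⇒≱ k<m)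
  where
  open ≤-Reasoning
  earlier : ∀ {B} → B ∈ ℐ → B ∈ colexPrefix k
  earlier {B} B∈ℐ with colexSet-surjective (All.lookup sets B∈ℐ)
  ... | j , refl with <-cmp j k
  ...   | tri< j<k _ _ = ∈-map⁺ colexSet (∈-downFrom⁺ j<k)
  ...   | tri≈ _ refl _ = contradiction B∈ℐ k∉ℐ
  ...   | tri> _ _ k<j = contradiction (downward (colexSet k) B (colexSet-IsFSet k) B∈ℐ (colexSet-colex k<j)) k∉ℐ
  m≤k : m ≤ k
  m≤k = begin
    m                       ≡⟨ |ℐ|≡m ⟨
    length ℐ                ≤⟨ length-⊆ ℐ (colexPrefix k) uℐ (All.tabulate earlier) ⟩
    length (colexPrefix k)  ≡⟨ length-map colexSet (downFrom k) ⟩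
    length (downFrom k)     ≡⟨ length-downFrom k ⟩
    k                       ∎

ones-≤-initial : ∀ {m ℐ} → IsInitialColex m ℐ → ones m ≤ ‖ ℐ ‖
ones-≤-initial {m} {ℐ} ℐ-initial = subst (_≤ ‖ ℐ ‖) (norm-colexPrefix m)
  (total-⊆ length (colexPrefix m) ℐ (Unique.map⁺ colexSet-injective (Unique.downFrom⁺ m))
           (All.tabulate inℐ))
  where
  inℐ : ∀ {B} → B ∈ colexPrefix m → B ∈ ℐ
  inℐ B∈ with ∈-map⁻ colexSet B∈
  ... | k , k∈ , refl = initial-contains ℐ-initial (∈-downFrom⁻ k∈)

lemma12 : (n : ℕ) (𝓑 : List FSet) → All (InPow n) 𝓑 → Unique 𝓑 →
    SimplyRooted 𝓑 → (ℐ : List FSet) → IsInitialColex (length 𝓑) ℐ →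
    ‖ 𝓑 ‖ ≤ (‖ ℐ ‖ + length 𝓑) ∸ m′ 𝓑
lemma12 n 𝓑 𝓑⊆[n] u𝓑 rooted ℐ ℐ-initial = m+n≤o⇒m≤o∸n ‖ 𝓑 ‖ (begin
  ‖ 𝓑 ‖ + m′ 𝓑                ≤⟨ norm+full≤edges+size 𝓑 rooted (All.map proj₁ 𝓑⊆[n]) ⟩
  edges 𝓑 + length 𝓑          ≤⟨ +-monoˡ-≤ (length 𝓑) (edges-≤-ones (suc n) 𝓑 (All.map below 𝓑⊆[n]) u𝓑) ⟩
  ones (length 𝓑) + length 𝓑  ≤⟨ +-monoˡ-≤ (length 𝓑) (ones-≤-initial ℐ-initial) ⟩
  ‖ ℐ ‖ + length 𝓑            ∎)
  where
  open ≤-Reasoning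
  below : ∀ {B} → InPow n B → Below (suc n) B
  below ((B↑ , _) , B≤n) = B↑ , All.map s≤s B≤n
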